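{- Let $n\ge 1$ be an integer and suppose the class of connected graphs with at most $n$ vertices has an isometric-universal graph with at most $g(n)$ vertices. Then the class $\mathcal{G}_n$ of all $n$-vertex graphs has an isometric-universal graph with at most $n\cdot g(n)$ vertices.
   Context: A subgraph $G$ of $H$ is isometric if $d_G(u,v)=d_H(u,v)$ for all $u,v\in V(G)$ (distances possibly $\infty$); $H$ is isometric-universal for a class $\mathcal{C}$ if it contains an isometric copy of every $G\in\mathcal{C}$. -}

module Defs where

open import Data.Nat using (ℕ; zero; suc; _<_)
open import Data.Fin using (Fin)
open import Data.Bool using (Bool; T)
open import Data.Maybe using (Maybe; just; nothing)
open import Data.Product using (Σ; _×_; ∃)
open import Relation.Binary.PropositionalEquality using (_≡_)
open import Relation.Nullary using (¬_)
open import Function using (_⇔_)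
open import Function.Definitions using (Injective)

record Graph (n : ℕ) : Set where
  field
    adj   : Fin n → Fin n → Bool
    sym   : ∀ u v → adj u v ≡ adj v u
    irrefl : ∀ u → adj u u ≡ Data.Bool.false
open Graph public

Adj : ∀ {n} → Graph n → Fin n → Fin n → Set
Adj G u v = T (adj G u v)

data Walk {n} (G : Graph n) : ℕ → Fin n → Fin n → Set where
  here : ∀ {u} → Walk G zero u u
  step : ∀ {k u w v} → Adj G u w → Walk G k w v → Walk G (suc k) u v

-- Extended naturals ℕ ∪ {∞}: nothing = ∞.
ℕ∞ : Set
ℕ∞ = Maybe ℕ

IsDist : ∀ {n} → Graph n → Fin n → Fin n → ℕ∞ → Set
IsDist G u v (just k) = Walk G k u v × (∀ j → j < k → ¬ Walk G j u v)
IsDist G u v nothing  = ∀ j → ¬ Walk G j u v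

Connected : ∀ {n} → Graph n → Set
Connected G = ∀ u v → ∃ λ k → Walk G k u v

-- G has an isometric copy in H: an injective adjacency-preserving map
-- (so its image with the image edges is a subgraph isomorphic to G)
-- such that distances in G equal distances in H between image vertices.
IsometricCopy : ∀ {m n} → Graph m → Graph n → Set
IsometricCopy {m} {n} G H =
  Σ (Fin m → Fin n) λ f →
    Injective _≡_ _≡_ f
    × (∀ u v → Adj G u v → Adj H (f u) (f v))
    × (∀ u v (d : ℕ∞) → IsDist G u v d ⇔ IsDist H (f u) (f v) d)

{-# OPTIONS --safe #-}
-- For a vertex r of G, attach every vertex outside the component of r to r by a pendant
-- edge. The resulting graph on the same n vertices is connected, and the leaves never
-- shorten a walk inside r's component, so that component is isometric in it. Embedding
-- this graph, for one representative r of each component, into its own copy of H maps G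
-- isometrically into n disjoint copies of H: distinct components stay at distance ∞
-- because distinct copies are not joined.
module Submission where

open import Defs hiding (sym)
open import Data.Nat using (ℕ; zero; suc; _≤_; _<_; _*_; _+_; z≤n; s≤s)
open import Data.Nat.Properties using (≤-refl; ≤-trans; ≤-<-trans; n≤1+n; m≤n⇒m≤1+n; m≤n⇒m<n∨m≡n; *-monoʳ-≤)
open import Data.Fin using (Fin; zero; suc; _≟_; toℕ; fromℕ<; combine; remQuot)
open import Data.Fin.Properties using (suc-injective; any?; injective⇒≤; toℕ-fromℕ<; remQuot-combine; combine-injective)
open import Data.Bool using (Bool; true; false; T; _∧_; _∨_; not)
open import Data.Bool.Properties using (T-∧; ∧-zeroʳ)
open import Data.Maybe using (Maybe; just; nothing; fromMaybe)
import Data.Maybe as Maybe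
open import Data.Maybe.Properties using (just-injective)
open import Data.Product using (Σ; _×_; _,_; proj₁; proj₂; ∃-syntax)
open import Data.Sum using (_⊎_; inj₁; inj₂)
open import Data.Empty using (⊥-elim)
open import Function using (_⇔_; mk⇔; _∘_)
open import Function.Bundles using (Equivalence)
import Function.Properties.Equivalence as ⇔
open import Function.Definitions using (Injective)
open import Relation.Nullary using (¬_; Dec; yes; no)
open import Relation.Nullary.Decidable using (isYes; toWitness; fromWitness; map′; _×-dec_; T?)
open import Relation.Binary.PropositionalEquality

open Equivalence using (to; from)

module _ {n} {G : Graph n} where

  adj-sym : ∀ {u v} → Adj G u v → Adj G v u
  adj-sym {u} {v} = subst T (Graph.sym G u v)

  snoc : ∀ {k u w v} → Walk G k u w → Adj G w v → Walk G (suc k) u v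
  snoc here      a = step a here
  snoc (step b W) a = step b (snoc W a)

  reverse : ∀ {k u v} → Walk G k u v → Walk G k v u
  reverse here       = here
  reverse (step a W) = snoc (reverse W) (adj-sym a)

  infixr 5 _++ʷ_
  _++ʷ_ : ∀ {k l u w v} → Walk G k u w → Walk G l w v → Walk G (k + l) u v
  here     ++ʷ V = V
  step a W ++ʷ V = step a (W ++ʷ V)

  walk? : ∀ k u v → Dec (Walk G k u v)
  walk? zero u v with u ≟ v
  ... | yes refl = yes here
  ... | no u≢v   = no λ { here → u≢v refl }
  walk? (suc k) u v with any? (λ w → T? (adj G u w) ×-dec walk? k w v)
  ... | yes (w , a , W) = yes (step a W)
  ... | no ∄w           = no λ { (step a W) → ∄w (_ , a , W) }

  vertexAt : ∀ {k u v} → Walk G k u v → Fin (suc k) → Fin n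
  vertexAt {u = u} here       _       = u
  vertexAt {u = u} (step _ _) zero    = u
  vertexAt         (step _ W) (suc i) = vertexAt W i

  vertexAt-zero : ∀ {k u v} (W : Walk G k u v) → vertexAt W zero ≡ u
  vertexAt-zero here       = refl
  vertexAt-zero (step _ _) = refl

  IsPath : ∀ {k u v} → Walk G k u v → Set
  IsPath W = Injective _≡_ _≡_ (vertexAt W)

  Path : ℕ → Fin n → Fin n → Set
  Path k u v = Σ (Walk G k u v) IsPath

  path-length< : ∀ {k u v} (P : Walk G k u v) → IsPath P → k < n
  path-length< _ = injective⇒≤

  pathFrom : ∀ {k u v} (P : Walk G k u v) → IsPath P → (i : Fin (suc k)) →
             ∃[ j ] Path j (vertexAt P i) v
  pathFrom P P-path zero rewrite vertexAt-zero P = _ , P , P-path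
  pathFrom (step _ P) P-path (suc i) = pathFrom P (suc-injective ∘ P-path) i

  walk⇒path : ∀ {k u v} → Walk G k u v → ∃[ j ] Path j u v
  walk⇒path here = zero , here , λ { {zero} {zero} _ → refl }
  walk⇒path {u = u} (step a W) with walk⇒path W
  ... | j , P , P-path with any? (λ i → u ≟ vertexAt P i)
  ...   | yes (i , refl) = pathFrom P P-path i
  ...   | no u∉P         = suc j , step a P , injective
    where
      injective : IsPath (step a P)
      injective {zero}  {zero}  _ = refl
      injective {zero}  {suc y} e = ⊥-elim (u∉P (y , e))
      injective {suc x} {zero}  e = ⊥-elim (u∉P (x , sym e))
      injective {suc x} {suc y} e = cong suc (P-path e)

Reachable : ∀ {n} → Graph n → Fin n → Fin n → Set
Reachable G u v = ∃[ k ] Walk G k u v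

module _ {n} (G : Graph n) where

  reachable-trans : ∀ {u v w} → Reachable G u v → Reachable G v w → Reachable G u w
  reachable-trans (k , W) (l , V) = k + l , W ++ʷ V

  reachable-sym : ∀ {u v} → Reachable G u v → Reachable G v u
  reachable-sym (k , W) = k , reverse W

  reachable? : ∀ u v → Dec (Reachable G u v)
  reachable? u v = map′ (λ (j , W) → toℕ j , W) viaPath (any? λ j → walk? (toℕ j) u v)
    where
      viaPath : Reachable G u v → ∃[ j ] Walk G (toℕ j) u v
      viaPath (_ , W) with walk⇒path W
      ... | j , P , P-path = fromℕ< j<n , subst (λ l → Walk G l u v) (sym (toℕ-fromℕ< j<n)) P
        where j<n = path-length< P P-path

firstSatisfying : ∀ {m} {P : Fin m → Set} → (∀ i → Dec (P i)) → Maybe (Fin m)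
firstSatisfying {zero}  P? = nothing
firstSatisfying {suc m} P? with P? zero
... | yes _ = just zero
... | no  _ = Maybe.map suc (firstSatisfying (P? ∘ suc))

firstSatisfying-cong : ∀ {m} {P Q : Fin m → Set} (P? : ∀ i → Dec (P i)) (Q? : ∀ i → Dec (Q i)) →
                       (∀ i → P i ⇔ Q i) → firstSatisfying P? ≡ firstSatisfying Q?
firstSatisfying-cong {zero}  P? Q? P⇔Q = refl
firstSatisfying-cong {suc m} P? Q? P⇔Q with P? zero | Q? zero
... | yes _  | yes _  = refl
... | yes p  | no ¬q  = ⊥-elim (¬q (to (P⇔Q zero) p))
... | no ¬p  | yes q  = ⊥-elim (¬p (from (P⇔Q zero) q))
... | no _   | no _   = cong (Maybe.map suc) (firstSatisfying-cong (P? ∘ suc) (Q? ∘ suc) (P⇔Q ∘ suc))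

firstSatisfying-just : ∀ {m} {P : Fin m → Set} (P? : ∀ i → Dec (P i)) {i} → P i →
                       ∃[ j ] firstSatisfying P? ≡ just j × P j
firstSatisfying-just {suc m} P? {i} p with P? zero
... | yes p₀ = zero , refl , p₀
... | no ¬p₀ with i
...   | zero  = ⊥-elim (¬p₀ p)
...   | suc i with firstSatisfying-just (P? ∘ suc) p
...     | j , first≡j , pⱼ = suc j , cong (Maybe.map suc) first≡j , pⱼ

module _ {n} (G : Graph n) where

  -- The fallback x is never used, since x is reachable from itself.
  rep : Fin n → Fin n
  rep x = fromMaybe x (firstSatisfying (reachable? G x))

  rep-spec : ∀ x → firstSatisfying (reachable? G x) ≡ just (rep x) × Reachable G x (rep x)
  rep-spec x with firstSatisfying-just (reachable? G x) (0 , here)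
  ... | j , first≡j , x↝j rewrite first≡j = refl , x↝j

  reachable-rep : ∀ x → Reachable G x (rep x)
  reachable-rep x = proj₂ (rep-spec x)

  rep-cong : ∀ {x y} → Reachable G x y → rep x ≡ rep y
  rep-cong {x} {y} x↝y = just-injective (begin
    just (rep x)                         ≡⟨ sym (proj₁ (rep-spec x)) ⟩
    firstSatisfying (reachable? G x)     ≡⟨ firstSatisfying-cong _ _ sameTargets ⟩
    firstSatisfying (reachable? G y)     ≡⟨ proj₁ (rep-spec y) ⟩
    just (rep y)                         ∎)
    where
      open ≡-Reasoning
      sameTargets : ∀ z → Reachable G x z ⇔ Reachable G y z
      sameTargets z = mk⇔ (reachable-trans G (reachable-sym G x↝y)) (reachable-trans G x↝y)

WalksDominate : ∀ {a b} → Graph a → Fin a → Fin a → Graph b → Fin b → Fin b → Set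
WalksDominate A u v B x y = ∀ k → Walk A k u v → ∃[ j ] j ≤ k × Walk B j x y

walkMap⇒dominate : ∀ {a b} {A : Graph a} {B : Graph b} {u v x y} →
                   (∀ {k} → Walk A k u v → Walk B k x y) → WalksDominate A u v B x y
walkMap⇒dominate f k W = k , ≤-refl , f W

isDist-⇔ : ∀ {a b} {A : Graph a} {B : Graph b} {u v x y} →
           WalksDominate A u v B x y → WalksDominate B x y A u v →
           ∀ d → IsDist A u v d ⇔ IsDist B x y d
isDist-⇔ A≽B B≽A (just k) = mk⇔ (transfer A≽B B≽A) (transfer B≽A A≽B)
  where
    transfer : ∀ {a b} {A : Graph a} {B : Graph b} {u v x y} →
               WalksDominate A u v B x y → WalksDominate B x y A u v →
               IsDist A u v (just k) → IsDist B x y (just k)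
    transfer A≽B B≽A (W , shortest) with A≽B _ W
    ... | j , j≤k , V with m≤n⇒m<n∨m≡n j≤k
    ...   | inj₁ j<k = ⊥-elim (let (i , i≤j , U) = B≽A j V in shortest i (≤-<-trans i≤j j<k) U)
    ...   | inj₂ refl = V , λ l l<k V′ → let (i , i≤l , U) = B≽A l V′ in shortest i (≤-<-trans i≤l l<k) U
isDist-⇔ A≽B B≽A nothing =
  mk⇔ (λ none j V → let (i , _ , U) = B≽A j V in none i U)
      (λ none j U → let (i , _ , V) = A≽B j U in none i V)

pendantAdj : (inU inV rootU rootV edge : Bool) → Bool
pendantAdj inU inV rootU rootV e = (inU ∧ inV ∧ e) ∨ (inU ∧ not inV ∧ rootU) ∨ (inV ∧ not inU ∧ rootV)

pendantAdj-sym : ∀ a b p q e → pendantAdj a b p q e ≡ pendantAdj b a q p e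
pendantAdj-sym true  true  p     q     e = refl
pendantAdj-sym true  false true  q     e = refl
pendantAdj-sym true  false false q     e = refl
pendantAdj-sym false true  p     true  e = refl
pendantAdj-sym false true  p     false e = refl
pendantAdj-sym false false p     q     e = refl

pendantAdj-irrefl : ∀ a p → pendantAdj a a p p false ≡ false
pendantAdj-irrefl true  p = refl
pendantAdj-irrefl false p = refl

pendantAdj-inside : ∀ {a b p q e} → T a → T b → T e → T (pendantAdj a b p q e)
pendantAdj-inside {true} {true} {e = true} _ _ _ = _

pendantAdj-leaf : ∀ {a b p q e} → ¬ T a → T b → T q → T (pendantAdj a b p q e)
pendantAdj-leaf {true}                    ¬a _ _ = ⊥-elim (¬a _)
pendantAdj-leaf {false} {true} {q = true} _  _ _ = _

pendantAdj-cases : ∀ {a b p q e} → T (pendantAdj a b p q e) →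
                   (T a × T b × T e) ⊎ (T a × ¬ T b × T p) ⊎ (T b × ¬ T a × T q)
pendantAdj-cases {true}  {true}  {e = true} _ = inj₁ (_ , _ , _)
pendantAdj-cases {true}  {false} {true}     _ = inj₂ (inj₁ (_ , (λ ()) , _))
pendantAdj-cases {false} {true}  {q = true} _ = inj₂ (inj₂ (_ , (λ ()) , _))

module Pendant {n} (G : Graph n) (r : Fin n) where

  InComponent : Fin n → Set
  InComponent x = Reachable G x r

  inComponent : Fin n → Bool
  inComponent x = isYes (reachable? G x r)

  isRoot : Fin n → Bool
  isRoot x = isYes (x ≟ r)

  ⟦_⟧ : ∀ {x} → T (inComponent x) → InComponent x
  ⟦_⟧ = toWitness

  ⌜_⌝ : ∀ {x} → InComponent x → T (inComponent x)
  ⌜_⌝ = fromWitness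

  pendantGraph : Graph n
  pendantGraph = record
    { adj    = λ u v → pendantAdj (inComponent u) (inComponent v) (isRoot u) (isRoot v) (adj G u v)
    ; sym    = λ u v → trans (cong (pendantAdj (inComponent u) (inComponent v) (isRoot u) (isRoot v)) (Graph.sym G u v))
                             (pendantAdj-sym (inComponent u) (inComponent v) (isRoot u) (isRoot v) (adj G v u))
    ; irrefl = λ u → trans (cong (pendantAdj (inComponent u) (inComponent u) (isRoot u) (isRoot u)) (Graph.irrefl G u))
                           (pendantAdj-irrefl (inComponent u) (isRoot u))
    }

  liftWalk : ∀ {k x y} → Walk G k x y → InComponent x → Walk pendantGraph k x y
  liftWalk here       _    = here
  liftWalk (step a W) x↝r = step (pendantAdj-inside ⌜ x↝r ⌝ ⌜ w↝r ⌝ a) (liftWalk W w↝r)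
    where w↝r = reachable-trans G (1 , step (adj-sym {G = G} a) here) x↝r

  -- A vertex outside r's component is a leaf at r, so a walk from it reaches y through r.
  lowerWalk : ∀ {k x y} → Walk pendantGraph k x y → InComponent y →
              (InComponent x → ∃[ j ] j ≤ k × Walk G j x y)
              × (¬ InComponent x → ∃[ j ] j < k × Walk G j r y)
  lowerWalk here y↝r = (λ _ → 0 , z≤n , here) , (λ x↜̸r → ⊥-elim (x↜̸r y↝r))
  lowerWalk (step a W) y↝r with pendantAdj-cases a | lowerWalk W y↝r
  ... | inj₁ (x∈ , w∈ , a′) | fromInside , _ =
        (λ _ → let (j , j≤ , V) = fromInside ⟦ w∈ ⟧ in suc j , s≤s j≤ , step a′ V)
      , (λ x∉ → ⊥-elim (x∉ ⟦ x∈ ⟧))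
  ... | inj₂ (inj₁ (x∈ , w∉ , x≡r)) | _ , fromLeaf =
        (λ _ → let (j , j<k , V) = fromLeaf (w∉ ∘ ⌜_⌝) in
               j , ≤-trans (n≤1+n j) (m≤n⇒m≤1+n j<k) , subst (λ z → Walk G j z _) (sym (toWitness x≡r)) V)
      , (λ x∉ → ⊥-elim (x∉ ⟦ x∈ ⟧))
  ... | inj₂ (inj₂ (w∈ , x∉ , w≡r)) | fromInside , _ =
        (λ x∈ → ⊥-elim (x∉ ⌜ x∈ ⌝))
      , (λ _ → let (j , j≤ , V) = fromInside ⟦ w∈ ⟧ in
               j , s≤s j≤ , subst (λ z → Walk G j z _) (toWitness w≡r) V)

  walkToRoot : ∀ x → Reachable pendantGraph x r
  walkToRoot x with reachable? G x r
  ... | yes (k , W) = k , liftWalk W (k , W)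
  ... | no  x↜̸r    = 1 , step (pendantAdj-leaf (x↜̸r ∘ ⟦_⟧) ⌜ 0 , here ⌝ (fromWitness refl)) here

  pendant-connected : Connected pendantGraph
  pendant-connected u v = reachable-trans pendantGraph (walkToRoot u) (reachable-sym pendantGraph (walkToRoot v))

  pendant-isDist : ∀ {u v} → InComponent u → InComponent v →
                   ∀ d → IsDist G u v d ⇔ IsDist pendantGraph u v d
  pendant-isDist u↝r v↝r = isDist-⇔ (walkMap⇒dominate (λ W → liftWalk W u↝r))
                                      (λ _ W → proj₁ (lowerWalk W v↝r) u↝r)

module Copies {N} (m : ℕ) (H : Graph N) where

  sameCopy : Fin m → Fin m → Bool
  sameCopy i j = isYes (i ≟ j)

  sameCopy-sym : ∀ i j → sameCopy i j ≡ sameCopy j i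
  sameCopy-sym i j with i ≟ j | j ≟ i
  ... | yes _   | yes _   = refl
  ... | yes i≡j | no  j≢i = ⊥-elim (j≢i (sym i≡j))
  ... | no  i≢j | yes j≡i = ⊥-elim (i≢j (sym j≡i))
  ... | no  _   | no  _   = refl

  copyAdj : Fin m × Fin N → Fin m × Fin N → Bool
  copyAdj (i , x) (j , y) = sameCopy i j ∧ adj H x y

  copies : Graph (m * N)
  copies = record
    { adj    = λ a b → copyAdj (remQuot {m} N a) (remQuot {m} N b)
    ; sym    = λ a b → cong₂ _∧_ (sameCopy-sym _ _) (Graph.sym H _ _)
    ; irrefl = λ a → trans (cong (sameCopy _ _ ∧_) (Graph.irrefl H _)) (∧-zeroʳ _)
    }

  adj-combine : ∀ i j x y → adj copies (combine i x) (combine j y) ≡ copyAdj (i , x) (j , y)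
  adj-combine i j x y = cong₂ copyAdj (remQuot-combine {m} {N} i x) (remQuot-combine {m} {N} j y)

  copies-adj : ∀ i {x y} → Adj H x y → Adj copies (combine i x) (combine i y)
  copies-adj i a = subst T (sym (adj-combine i i _ _)) (from T-∧ (fromWitness refl , a))

  liftWalk : ∀ i {k x y} → Walk H k x y → Walk copies k (combine i x) (combine i y)
  liftWalk i here       = here
  liftWalk i (step a W) = step (copies-adj i a) (liftWalk i W)

  copyOf : Fin (m * N) → Fin m
  copyOf a = proj₁ (remQuot {m} N a)

  vertexOf : Fin (m * N) → Fin N
  vertexOf a = proj₂ (remQuot {m} N a)

  projectWalk′ : ∀ {k a b} → Walk copies k a b → copyOf a ≡ copyOf b × Walk H k (vertexOf a) (vertexOf b)
  projectWalk′ here = refl , here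
  projectWalk′ {a = a} (step {w = w} e W)
    with to (T-∧ {sameCopy (copyOf a) (copyOf w)} {adj H (vertexOf a) (vertexOf w)}) e | projectWalk′ W
  ... | same , e′ | a≈b , V = trans (toWitness same) a≈b , step e′ V

  projectWalk : ∀ {k i j x y} → Walk copies k (combine i x) (combine j y) → i ≡ j × Walk H k x y
  projectWalk {k} {i} {j} {x} {y} W =
    subst₂ (λ p q → proj₁ p ≡ proj₁ q × Walk H k (proj₂ p) (proj₂ q))
           (remQuot-combine {m} {N} i x) (remQuot-combine {m} {N} j y) (projectWalk′ W)

  copies-isDist : ∀ i {x y} d → IsDist H x y d ⇔ IsDist copies (combine i x) (combine i y) d
  copies-isDist i = isDist-⇔ (walkMap⇒dominate (liftWalk i)) (walkMap⇒dominate (proj₂ ∘ projectWalk))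

module _ {n N} (G : Graph n) (H : Graph N)
         (embed : (G′ : Graph n) → Connected G′ → IsometricCopy G′ H) where

  open Pendant G using (pendantGraph; pendant-connected; pendant-isDist)
  open Copies n H using (copies; copies-adj; copies-isDist; projectWalk)

  φ : Fin n → Fin n → Fin N
  φ r = proj₁ (embed (pendantGraph r) (pendant-connected r))

  φ-injective : ∀ r → Injective _≡_ _≡_ (φ r)
  φ-injective r = proj₁ (proj₂ (embed (pendantGraph r) (pendant-connected r)))

  φ-adj : ∀ r u v → Adj (pendantGraph r) u v → Adj H (φ r u) (φ r v)
  φ-adj r = proj₁ (proj₂ (proj₂ (embed (pendantGraph r) (pendant-connected r))))

  φ-isDist : ∀ r u v d → IsDist (pendantGraph r) u v d ⇔ IsDist H (φ r u) (φ r v) d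
  φ-isDist r = proj₂ (proj₂ (proj₂ (embed (pendantGraph r) (pendant-connected r))))

  F : Fin n → Fin (n * N)
  F u = combine (rep G u) (φ (rep G u) u)

  F-sameComponent : ∀ {u v} → rep G u ≡ rep G v → F v ≡ combine (rep G u) (φ (rep G u) v)
  F-sameComponent e = cong (λ r → combine r (φ r _)) (sym e)

  reaches-rep-of : ∀ {u v} → rep G u ≡ rep G v → Reachable G v (rep G u)
  reaches-rep-of {u} e = subst (Reachable G _) (sym e) (reachable-rep G _)

  F-injective : Injective _≡_ _≡_ F
  F-injective {u} {v} Fu≡Fv = φ-injective r (proj₂ (combine-injective r (φ r u) r (φ r v) Fu≡Fr))
    where
      r = rep G u
      Fu≡Fr = trans Fu≡Fv (F-sameComponent (proj₁ (combine-injective r (φ r u) (rep G v) (φ (rep G v) v) Fu≡Fv)))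

  F-adj : ∀ u v → Adj G u v → Adj copies (F u) (F v)
  F-adj u v a = subst (Adj copies (F u)) (sym (F-sameComponent e)) (copies-adj r (φ-adj r u v a′))
    where
      r = rep G u
      e = rep-cong G (1 , step a here)
      a′ = pendantAdj-inside (Pendant.⌜_⌝ G r (reachable-rep G u)) (Pendant.⌜_⌝ G r (reaches-rep-of e)) a

  F-isDist : ∀ u v d → IsDist G u v d ⇔ IsDist copies (F u) (F v) d
  F-isDist u v d with rep G u ≟ rep G v
  ... | no  u≁v = isDist-⇔ (λ k W → ⊥-elim (u≁v (rep-cong G (k , W))))
                           (λ k W → ⊥-elim (u≁v (proj₁ (projectWalk W)))) d
  ... | yes e = subst (λ z → IsDist G u v d ⇔ IsDist copies (F u) z d) (sym (F-sameComponent e))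
      (⇔.trans (pendant-isDist r (reachable-rep G u) (reaches-rep-of e) d)
      (⇔.trans (φ-isDist r u v d) (copies-isDist r d)))
    where r = rep G u

  isometricInCopies : IsometricCopy G copies
  isometricInCopies = F , F-injective , F-adj , F-isDist

proposition2p3 : (n g : ℕ) → 1 ≤ n
    → Σ ℕ (λ N → N ≤ g × Σ (Graph N) λ H →
         ∀ m → m ≤ n → (G : Graph m) → Connected G → IsometricCopy G H)
    → Σ ℕ (λ N → N ≤ n * g × Σ (Graph N) λ H →
         (G : Graph n) → IsometricCopy G H)
proposition2p3 n g _ (N , N≤g , H , universal) =
  n * N , *-monoʳ-≤ n N≤g , Copies.copies n H ,
  λ G → isometricInCopies G H (universal n ≤-refl)
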